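{- Let $\mathcal{T}$ be the set of permutations constructed as follows. Take $n\ge 3$ and $\alpha\in\operatorname{Av}_n(132)$ with $\alpha_1=n$ and $\alpha_n=n-1$. Choose a set $S\subseteq\{2,\dots,n-1\}$ that contains every $r\in\{2,\dots,n-1\}$ such that the values $r-1$ and $r$ occupy adjacent positions in $\alpha$. Write $S=\{r_1<\cdots<r_k\}$ and let $\sigma$ be the unique permutation of length $n+k$ such that $\sigma_1<\sigma_2<\cdots<\sigma_k$, the sequence $\sigma_{k+1}\cdots\sigma_{k+n}$ is order-isomorphic to $\alpha$, and for each $j\le k$ the value $\sigma_j$ lies strictly between $\sigma_{k+a}$ and $\sigma_{k+b}$, where $\alpha_a=r_j-1$ and $\alpha_b=r_j$ (i.e., one new leading maximum is inserted just below the row of value $r_j$ of $\alpha$). Then $$\operatorname{Si}(\operatorname{Av}(2143,3142,4132))=\mathcal{T}\cup\{1,12,21\}.$$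
   Context: For $i\le j$, a set of consecutive positions $[i,j]$ is an interval of a permutation $\sigma$ of length $n$ if $\{\sigma_i,\dots,\sigma_j\}$ is a set of consecutive integers; $\sigma$ is simple if its only intervals have length $1$ or $n$. $\operatorname{Si}(A)$ is the set of simple permutations in $A$. $\operatorname{Av}_n(T)$ (resp. $\operatorname{Av}(T)$) is the set of permutations of length $n$ (resp. of any length) avoiding every pattern in $T$. -}

module Defs where

open import Data.Nat using (ℕ; zero; suc; _+_; _∸_; _≤_; _<_)
open import Data.Fin as Fin using (Fin; toℕ; _↑ˡ_; _↑ʳ_)
open import Data.Vec using (Vec; []; _∷_; lookup)
open import Data.Product using (Σ; ∃; ∃-syntax; _×_; _,_)
open import Data.Sum using (_⊎_)
open import Relation.Nullary using (¬_)
open import Relation.Binary.PropositionalEquality using (_≡_)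
open import Function using (_∘_)
open import Function.Bundles using (_⇔_)
open import Function.Definitions using (Injective)

-- A permutation of length n is an injective map σ : Fin n → Fin n
-- (positions 0..n-1, values 0..n-1).  We read off the 1-based values.
seq : {n : ℕ} → (Fin n → Fin n) → Fin n → ℕ
seq σ i = suc (toℕ (σ i))

IsPerm : {n : ℕ} → (Fin n → Fin n) → Set
IsPerm σ = Injective _≡_ _≡_ σ

OrderIso : {k : ℕ} → (Fin k → ℕ) → (Fin k → ℕ) → Set
OrderIso {k} f g = (i j : Fin k) → (f i < f j) ⇔ (g i < g j)

Contains : {n k : ℕ} → (Fin n → ℕ) → (Fin k → ℕ) → Set
Contains {n} {k} σ π =
  Σ (Fin k → Fin n) λ f →
    ((i j : Fin k) → i Fin.< j → f i Fin.< f j) × OrderIso (σ ∘ f) π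

Avoids : {n k : ℕ} → (Fin n → ℕ) → (Fin k → ℕ) → Set
Avoids σ π = ¬ Contains σ π

p132 : Fin 3 → ℕ
p132 = lookup (1 ∷ 3 ∷ 2 ∷ [])

p2143 : Fin 4 → ℕ
p2143 = lookup (2 ∷ 1 ∷ 4 ∷ 3 ∷ [])

p3142 : Fin 4 → ℕ
p3142 = lookup (3 ∷ 1 ∷ 4 ∷ 2 ∷ [])

p4132 : Fin 4 → ℕ
p4132 = lookup (4 ∷ 1 ∷ 3 ∷ 2 ∷ [])

IsInterval : {n : ℕ} → (Fin n → Fin n) → Fin n → Fin n → Set
IsInterval {n} σ i j =
  ∃[ c ] ∃[ L ] ((v : ℕ) →
    (c ≤ v × v < c + L) ⇔ (∃[ p ] (i Fin.≤ p × p Fin.≤ j × seq σ p ≡ v)))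

Simple : {n : ℕ} → (Fin n → Fin n) → Set
Simple {n} σ = (i j : Fin n) → i Fin.≤ j → IsInterval σ i j →
  (suc (toℕ j ∸ toℕ i) ≡ 1) ⊎ (suc (toℕ j ∸ toℕ i) ≡ n)

InAv : {n : ℕ} → (Fin n → Fin n) → Set
InAv σ = Avoids (seq σ) p2143 × Avoids (seq σ) p3142 × Avoids (seq σ) p4132

StrictlyBetween : ℕ → ℕ → ℕ → Set
StrictlyBetween v x y = (x < v × v < y) ⊎ (y < v × v < x)

data InT : (m : ℕ) → (Fin m → Fin m) → Set where
  mkT : (n k : ℕ) → 3 ≤ n →
        (α : Fin n → Fin n) → IsPerm α → Avoids (seq α) p132 →
        (top : Fin n) → toℕ top ≡ 0 → seq α top ≡ n →
        (bot : Fin n) → suc (toℕ bot) ≡ n → seq α bot ≡ n ∸ 1 →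
        (r : Fin k → ℕ) →
        ((j : Fin k) → 2 ≤ r j × r j ≤ n ∸ 1) →
        ((i j : Fin k) → i Fin.< j → r i < r j) →
        ((s : ℕ) → 2 ≤ s → s ≤ n ∸ 1 → (a b : Fin n) →
           seq α a ≡ s ∸ 1 → seq α b ≡ s →
           (suc (toℕ a) ≡ toℕ b ⊎ suc (toℕ b) ≡ toℕ a) →
           ∃[ j ] r j ≡ s) →
        (σ : Fin (k + n) → Fin (k + n)) → IsPerm σ →
        ((i j : Fin k) → i Fin.< j → seq σ ((i ↑ˡ n)) < seq σ ((j ↑ˡ n))) →
        OrderIso (λ a → seq σ ((k ↑ʳ a))) (seq α) →
        ((j : Fin k) (a b : Fin n) → seq α a ≡ r j ∸ 1 → seq α b ≡ r j →
           StrictlyBetween (seq σ ((j ↑ˡ n))) (seq σ ((k ↑ʳ a))) (seq σ ((k ↑ʳ b)))) →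
        InT (k + n) σ

data Small : (m : ℕ) → (Fin m → Fin m) → Set where
  one    : (σ : Fin 1 → Fin 1) → seq σ Fin.zero ≡ 1 → Small 1 σ
  twelve : (σ : Fin 2 → Fin 2) → seq σ Fin.zero ≡ 1 → seq σ (Fin.suc Fin.zero) ≡ 2 → Small 2 σ
  twentyone : (σ : Fin 2 → Fin 2) → seq σ Fin.zero ≡ 2 → seq σ (Fin.suc Fin.zero) ≡ 1 → Small 2 σ

-- Members of 𝒯 are simple: a proper interval inside the suffix would, as α
-- avoids 132, contain two neighbours with consecutive values r − 1 and r, and
-- the entry inserted between them lies outside; intervals meeting the
-- increasing prefix are broken by the inserted entries or by the two largest
-- values.  Each of 2143, 3142, 4132 is a 132 whose '1' follows a larger entry,
-- which cannot occur since the prefix increases and the suffix avoids 132.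
--
-- Conversely, split a simple avoider of length ≥ 3 just before its maximum.
-- Simplicity means that every proper window has an outside entry whose value
-- separates two inside values; combined with the forbidden patterns this forces
-- the prefix to increase, the suffix to avoid 132 and end with the second
-- largest value, and each pair of neighbours in the suffix with consecutive
-- values to be separated by a prefix entry.  Standardising the suffix gives α,
-- and counting the suffix values below each prefix entry gives the r_j.

module Submission where

open import Defs
open import Data.Nat using (ℕ; zero; suc; _+_; _∸_; _≤_; _<_; z≤n; s≤s; z<s; s<s; _≤?_; _<?_; _≟_)
open import Data.Nat.Properties
open import Data.Fin as F using (Fin; toℕ; fromℕ<; inject₁; _↑ˡ_; _↑ʳ_; splitAt)
import Data.Fin.Properties as FP
open import Data.Fin.Patterns using (0F; 1F; 2F; 3F)
open import Data.Vec using ([]; _∷_; lookup)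
open import Data.Product using (Σ; ∃; ∃-syntax; _×_; _,_; proj₁; proj₂)
open import Data.Sum using (_⊎_; inj₁; inj₂; [_,_]; swap)
open import Data.Empty using (⊥; ⊥-elim)
open import Data.Unit using (⊤; tt)
open import Relation.Nullary using (¬_; ¬?; yes; no; _×-dec_)
open import Relation.Nullary.Negation using (contradiction)
open import Relation.Nullary.Decidable using (True; toWitness)
open import Relation.Binary using (Rel; Total; Transitive; Reflexive; Tri; tri<; tri≈; tri>)
open import Relation.Unary using (Decidable)
open import Relation.Binary.PropositionalEquality using (_≡_; _≢_; refl; sym; trans; cong; subst; subst₂)
open import Function using (_∘_)
open import Function.Bundles using (_⇔_; mk⇔; Equivalence)
open Equivalence using (to; from)
open import Function.Definitions using (Injective)

<-literal : ∀ {a b} {_ : True (a <? b)} → a < b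
<-literal {_} {_} {w} = toWitness w

n∸1<n : ∀ {n} → 0 < n → n ∸ 1 < n
n∸1<n {suc n} _ = n<1+n n

suc[n∸1]≡n : ∀ {n} → 0 < n → suc (n ∸ 1) ≡ n
suc[n∸1]≡n {suc n} _ = refl

<⇒≤∸1 : ∀ {m n} → m < n → m ≤ n ∸ 1
<⇒≤∸1 {n = suc n} (s≤s m≤n) = m≤n

injective⇒surjective : ∀ {n} {f : Fin n → Fin n} → Injective _≡_ _≡_ f → ∀ y → ∃ λ x → f x ≡ y
injective⇒surjective {zero} _ ()
injective⇒surjective {suc n} {f} f-inj y with FP.any? (λ x → f x FP.≟ y)
... | yes hit = hit
... | no miss = contradiction (FP.injective⇒≤ punched-injective) (<⇒≱ (n<1+n n))
  where
  avoids : ∀ x → y ≢ f x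
  avoids x eq = miss (x , sym eq)
  punched-injective : Injective _≡_ _≡_ (λ x → F.punchOut (avoids x))
  punched-injective {x} {z} eq = f-inj (FP.punchOut-injective (avoids x) (avoids z) eq)

module _ {a ℓ} {A : Set a} {_≼_ : Rel A ℓ}
         (≼-total : Total _≼_) (≼-trans : Transitive _≼_) (≼-refl : Reflexive _≼_) where

  optimum : ∀ {n} {P : Fin n → Set} → Decidable P → (g : Fin n → A) → ∃ P →
            Σ (Fin n) λ t → P t × (∀ x → P x → g x ≼ g t)
  optimum {zero} _ _ (() , _)
  optimum {suc n} {P} P? g witness with FP.any? (P? ∘ F.suc)
  ... | no none = F.zero , head witness , λ { F.zero _ → ≼-refl ; (F.suc x) px → contradiction (x , px) none }
    where
    head : ∃ P → P F.zero
    head (F.zero , p) = p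
    head (F.suc x , px) = contradiction (x , px) none
  ... | yes some with optimum (P? ∘ F.suc) (g ∘ F.suc) some | P? F.zero
  ...   | t , pt , best | no ¬p0 = F.suc t , pt , λ { F.zero p0 → contradiction p0 ¬p0 ; (F.suc x) px → best x px }
  ...   | t , pt , best | yes p0 =
    [ (λ 0≼t → F.suc t , pt , λ { F.zero _ → 0≼t ; (F.suc x) px → best x px })
    , (λ t≼0 → F.zero , p0 , λ { F.zero _ → ≼-refl ; (F.suc x) px → ≼-trans (best x px) t≼0 })
    ] (≼-total (g F.zero) (g (F.suc t)))

argmax : ∀ {n} {P : Fin n → Set} → Decidable P → (g : Fin n → ℕ) → ∃ P →
         Σ (Fin n) λ t → P t × (∀ x → P x → g x ≤ g t)
argmax = optimum ≤-total ≤-trans ≤-refl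

argmin : ∀ {n} {P : Fin n → Set} → Decidable P → (g : Fin n → ℕ) → ∃ P →
         Σ (Fin n) λ t → P t × (∀ x → P x → g t ≤ g x)
argmin = optimum (λ x y → ≤-total y x) (λ x≥y y≥z → ≤-trans y≥z x≥y) ≤-refl

count : ∀ {n} {P : Fin n → Set} → Decidable P → ℕ
count {zero} _ = 0
count {suc n} P? with P? F.zero
... | yes _ = suc (count (P? ∘ F.suc))
... | no _ = count (P? ∘ F.suc)

count-mono : ∀ {n} {P Q : Fin n → Set} (P? : Decidable P) (Q? : Decidable Q) →
             (∀ x → P x → Q x) → count P? ≤ count Q?
count-mono {zero} _ _ _ = z≤n
count-mono {suc n} P? Q? P⊆Q with P? F.zero | Q? F.zero
... | yes _ | yes _ = s≤s (count-mono _ _ (P⊆Q ∘ F.suc))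
... | yes p | no ¬q = contradiction (P⊆Q F.zero p) ¬q
... | no _ | yes _ = m≤n⇒m≤1+n (count-mono _ _ (P⊆Q ∘ F.suc))
... | no _ | no _ = count-mono _ _ (P⊆Q ∘ F.suc)

count-strictMono : ∀ {n} {P Q : Fin n → Set} (P? : Decidable P) (Q? : Decidable Q) →
                   (∀ x → P x → Q x) → (y : Fin n) → Q y → ¬ P y → count P? < count Q?
count-strictMono P? Q? P⊆Q F.zero qy ¬py with P? F.zero | Q? F.zero
... | yes p | _ = contradiction p ¬py
... | no _ | no ¬q = contradiction qy ¬q
... | no _ | yes _ = s≤s (count-mono _ _ (P⊆Q ∘ F.suc))
count-strictMono P? Q? P⊆Q (F.suc y) qy ¬py with P? F.zero | Q? F.zero
... | yes _ | yes _ = s≤s (count-strictMono _ _ (P⊆Q ∘ F.suc) y qy ¬py)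
... | yes p | no ¬q = contradiction (P⊆Q F.zero p) ¬q
... | no _ | yes _ = m<n⇒m<1+n (count-strictMono _ _ (P⊆Q ∘ F.suc) y qy ¬py)
... | no _ | no _ = count-strictMono _ _ (P⊆Q ∘ F.suc) y qy ¬py

count≤n : ∀ {n} {P : Fin n → Set} (P? : Decidable P) → count P? ≤ n
count≤n {zero} _ = z≤n
count≤n {suc n} P? with P? F.zero
... | yes _ = s≤s (count≤n _)
... | no _ = m≤n⇒m≤1+n (count≤n _)

count-all : ∀ {n} {P : Fin n → Set} (P? : Decidable P) → (∀ x → P x) → count P? ≡ n
count-all {zero} _ _ = refl
count-all {suc n} P? all with P? F.zero
... | yes _ = cong suc (count-all _ (all ∘ F.suc))
... | no ¬p = contradiction (all F.zero) ¬p

count-allBut : ∀ {n} {P : Fin n → Set} (P? : Decidable P) (t : Fin n) →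
               (∀ x → x ≢ t → P x) → n ∸ 1 ≤ count P?
count-allBut {suc n} P? F.zero all with P? F.zero
... | yes _ = m≤n⇒m≤1+n (≤-reflexive (sym (count-all _ (λ x → all (F.suc x) λ ()))))
... | no _ = ≤-reflexive (sym (count-all _ (λ x → all (F.suc x) λ ())))
count-allBut {suc n} P? (F.suc t) all with P? F.zero
... | yes _ = ≤-trans (m≤n+m∸n n 1) (s≤s (count-allBut _ t (λ x x≢t → all (F.suc x) (x≢t ∘ FP.suc-injective))))
... | no ¬p = contradiction (all F.zero λ ()) ¬p

count-pos : ∀ {n} {P : Fin n → Set} (P? : Decidable P) (y : Fin n) → P y → 0 < count P?
count-pos P? y py = ≤-<-trans z≤n (count-strictMono {P = λ _ → ⊥} (λ _ → no λ ()) P? (λ _ ()) y py λ ())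

increasing-by-steps : ∀ {n} (f : Fin (suc n) → ℕ) → (∀ i → f (inject₁ i) < f (F.suc i)) →
                      ∀ i j → i F.< j → f i < f j
increasing-by-steps f step F.zero (F.suc F.zero) _ = step F.zero
increasing-by-steps {suc n} f step F.zero (F.suc (F.suc j)) _ =
  <-trans (step F.zero) (increasing-by-steps (f ∘ F.suc) (step ∘ F.suc) F.zero (F.suc j) z<s)
increasing-by-steps {suc n} f step (F.suc i) (F.suc j) (s<s i<j) =
  increasing-by-steps (f ∘ F.suc) (step ∘ F.suc) i j i<j

orderIso-byRanks : ∀ {k} (g p : Fin k → ℕ) (w : Fin k → Fin k) →
                   (∀ i → ∃ λ a → w a ≡ i) → (∀ a → p (w a) ≡ suc (toℕ a)) →
                   (∀ a b → a F.< b → g (w a) < g (w b)) → OrderIso g p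
orderIso-byRanks g p w w-onto rank g-incr i j with w-onto i | w-onto j
... | a , refl | b , refl = mk⇔ forward backward
  where
  backward : p (w a) < p (w b) → g (w a) < g (w b)
  backward lt = g-incr a b (≤-pred (subst₂ _<_ (rank a) (rank b) lt))
  forward : g (w a) < g (w b) → p (w a) < p (w b)
  forward lt = subst₂ _<_ (sym (rank a)) (sym (rank b)) (s≤s a<b)
    where
    a<b : a F.< b
    a<b with <-cmp (toℕ a) (toℕ b)
    ... | tri< a<b _ _ = a<b
    ... | tri≈ _ a≡b _ = contradiction (subst (λ x → g (w a) < g (w x)) (sym (FP.toℕ-injective a≡b)) lt) (<-irrefl refl)
    ... | tri> _ _ b<a = contradiction (g-incr b a b<a) (<-asym lt)

contains-byRanks : ∀ {m k} (s : Fin m → ℕ) (p : Fin (suc k) → ℕ) (w : Fin (suc k) → Fin (suc k)) →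
                   (∀ i → ∃ λ a → w a ≡ i) → (∀ a → p (w a) ≡ suc (toℕ a)) →
                   (f : Fin (suc k) → Fin m) → (∀ i → f (inject₁ i) F.< f (F.suc i)) →
                   (∀ a → s (f (w (inject₁ a))) < s (f (w (F.suc a)))) → Contains s p
contains-byRanks s p w w-onto rank f f-steps s-steps =
  f , increasing-by-steps (toℕ ∘ f) f-steps ,
  orderIso-byRanks (s ∘ f) p w w-onto rank (increasing-by-steps (s ∘ f ∘ w) s-steps)

module _ {m : ℕ} (s : Fin m → ℕ) where

  Occurs132 : Fin m → Fin m → Fin m → Set
  Occurs132 a b c = a F.< b × b F.< c × s a < s c × s c < s b

  Descent132 : Set
  Descent132 = ∃ λ a → ∃ λ b → ∃ λ c → ∃ λ d → a F.< b × s b < s a × Occurs132 b c d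

  contains-132 : ∀ {a b c} → Occurs132 a b c → Contains s p132
  contains-132 {a} {b} {c} (ab , bc , ac , cb) =
    contains-byRanks s p132 (lookup (0F ∷ 2F ∷ 1F ∷ []))
      (λ { 0F → 0F , refl ; 1F → 2F , refl ; 2F → 1F , refl })
      (λ { 0F → refl ; 1F → refl ; 2F → refl })
      (lookup (a ∷ b ∷ c ∷ [])) (λ { 0F → ab ; 1F → bc }) (λ { 0F → ac ; 1F → cb })

  contains-2143 : ∀ {a b c d} → a F.< b → b F.< c → c F.< d →
                  s b < s a → s a < s d → s d < s c → Contains s p2143
  contains-2143 {a} {b} {c} {d} ab bc cd ba ad dc =
    contains-byRanks s p2143 (lookup (1F ∷ 0F ∷ 3F ∷ 2F ∷ []))
      (λ { 0F → 1F , refl ; 1F → 0F , refl ; 2F → 3F , refl ; 3F → 2F , refl })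
      (λ { 0F → refl ; 1F → refl ; 2F → refl ; 3F → refl })
      (lookup (a ∷ b ∷ c ∷ d ∷ [])) (λ { 0F → ab ; 1F → bc ; 2F → cd }) (λ { 0F → ba ; 1F → ad ; 2F → dc })

  contains-3142 : ∀ {a b c d} → a F.< b → b F.< c → c F.< d →
                  s b < s d → s d < s a → s a < s c → Contains s p3142
  contains-3142 {a} {b} {c} {d} ab bc cd bd da ac =
    contains-byRanks s p3142 (lookup (1F ∷ 3F ∷ 0F ∷ 2F ∷ []))
      (λ { 0F → 2F , refl ; 1F → 0F , refl ; 2F → 3F , refl ; 3F → 1F , refl })
      (λ { 0F → refl ; 1F → refl ; 2F → refl ; 3F → refl })
      (lookup (a ∷ b ∷ c ∷ d ∷ [])) (λ { 0F → ab ; 1F → bc ; 2F → cd }) (λ { 0F → bd ; 1F → da ; 2F → ac })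

  contains-4132 : ∀ {a b c d} → a F.< b → b F.< c → c F.< d →
                  s b < s d → s d < s c → s c < s a → Contains s p4132
  contains-4132 {a} {b} {c} {d} ab bc cd bd dc ca =
    contains-byRanks s p4132 (lookup (1F ∷ 3F ∷ 2F ∷ 0F ∷ []))
      (λ { 0F → 3F , refl ; 1F → 0F , refl ; 2F → 2F , refl ; 3F → 1F , refl })
      (λ { 0F → refl ; 1F → refl ; 2F → refl ; 3F → refl })
      (lookup (a ∷ b ∷ c ∷ d ∷ [])) (λ { 0F → ab ; 1F → bc ; 2F → cd }) (λ { 0F → bd ; 1F → dc ; 2F → ca })

  occurs132 : Contains s p132 → ∃ λ a → ∃ λ b → ∃ λ c → Occurs132 a b c
  occurs132 (f , f-incr , iso) =
    f 0F , f 1F , f 2F , f-incr 0F 1F z<s , f-incr 1F 2F (s<s z<s) ,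
    from (iso 0F 2F) <-literal , from (iso 2F 1F) <-literal

  descent132 : (p : Fin 4 → ℕ) → p 1F < p 0F → p 1F < p 3F → p 3F < p 2F → Contains s p → Descent132
  descent132 p p10 p13 p32 (f , f-incr , iso) =
    f 0F , f 1F , f 2F , f 3F , f-incr 0F 1F z<s , from (iso 1F 0F) p10 ,
    f-incr 1F 2F (s<s z<s) , f-incr 2F 3F (s<s (s<s z<s)) , from (iso 1F 3F) p13 , from (iso 3F 2F) p32

seq-injective : ∀ {m} {σ : Fin m → Fin m} → IsPerm σ → ∀ {a b} → seq σ a ≡ seq σ b → a ≡ b
seq-injective σ-inj eq = σ-inj (FP.toℕ-injective (suc-injective eq))

seq≤ : ∀ {m} (σ : Fin m → Fin m) x → seq σ x ≤ m
seq≤ σ x = FP.toℕ<n (σ x)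

seq-onto : ∀ {m} {σ : Fin m → Fin m} → IsPerm σ → ∀ v → 0 < v → v ≤ m → ∃ λ x → seq σ x ≡ v
seq-onto σ-inj (suc v) _ v<m with injective⇒surjective σ-inj (fromℕ< v<m)
... | x , σx≡v = x , cong suc (trans (cong toℕ σx≡v) (FP.toℕ-fromℕ< v<m))

module Windows {m : ℕ} (σ : Fin m → Fin m) (σ-inj : IsPerm σ) where

  Window : Fin m → Fin m → Fin m → Set
  Window i j x = i F.≤ x × x F.≤ j

  window? : ∀ i j → Decidable (Window i j)
  window? i j x = (toℕ i ≤? toℕ x) ×-dec (toℕ x ≤? toℕ j)

  start∈window : ∀ {i j} → i F.≤ j → Window i j i
  start∈window i≤j = ≤-refl , i≤j

  end∈window : ∀ {i j} → i F.≤ j → Window i j j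
  end∈window i≤j = i≤j , ≤-refl

  outside-window : ∀ {i j t} → ¬ Window i j t → t F.< i ⊎ j F.< t
  outside-window {i} {j} {t} t∉ with toℕ i ≤? toℕ t | toℕ t ≤? toℕ j
  ... | no i≰t | _ = inj₁ (≰⇒> i≰t)
  ... | yes i≤t | no t≰j = inj₂ (≰⇒> t≰j)
  ... | yes i≤t | yes t≤j = contradiction (i≤t , t≤j) t∉

  Unseparated : Fin m → Fin m → Set
  Unseparated i j = ∀ {t a b} → ¬ Window i j t → Window i j a → Window i j b →
                    seq σ a < seq σ t → seq σ t < seq σ b → ⊥

  Proper : Fin m → Fin m → Set
  Proper i j = 0 < toℕ i ⊎ suc (toℕ j) < m

  interval-convex : ∀ {i j a b v} → IsInterval σ i j → Window i j a → Window i j b →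
                    seq σ a < v → v < seq σ b → ∃ λ t → Window i j t × seq σ t ≡ v
  interval-convex {a = a} {b} {v} (c , L , values) (ia , aj) (ib , bj) av vb
    with from (values (seq σ a)) (a , ia , aj , refl) | from (values (seq σ b)) (b , ib , bj , refl)
  ... | c≤a , _ | _ , b<c+L with to (values v) (≤-trans c≤a (<⇒≤ av) , <-trans vb b<c+L)
  ... | t , it , tj , t↦v = t , (it , tj) , t↦v

  interval-closed : ∀ {i j a b x} → IsInterval σ i j → Window i j a → Window i j b →
                    seq σ a < seq σ x → seq σ x < seq σ b → Window i j x
  interval-closed interval wa wb ax xb with interval-convex interval wa wb ax xb
  ... | t , wt , t↦x = subst (Window _ _) (seq-injective σ-inj t↦x) wt

  unseparated⇒interval : ∀ {i j} → i F.≤ j → Unseparated i j → IsInterval σ i j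
  unseparated⇒interval {i} {j} i≤j unseparated
    with argmin (window? i j) (seq σ) (i , ≤-refl , i≤j) | argmax (window? i j) (seq σ) (i , ≤-refl , i≤j)
  ... | lo , w-lo , lo-min | hi , w-hi , hi-max =
    seq σ lo , suc (seq σ hi) ∸ seq σ lo , λ v → mk⇔ (attained v) (bounded v)
    where
    top : seq σ lo + (suc (seq σ hi) ∸ seq σ lo) ≡ suc (seq σ hi)
    top = m+[n∸m]≡n (m≤n⇒m≤1+n (lo-min hi w-hi))
    attained : ∀ v → seq σ lo ≤ v × v < seq σ lo + (suc (seq σ hi) ∸ seq σ lo) →
               ∃[ p ] (i F.≤ p × p F.≤ j × seq σ p ≡ v)
    attained v (lo≤v , v<top) with seq-onto σ-inj v (<-≤-trans z<s lo≤v) (≤-trans v≤hi (seq≤ σ hi))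
      where
      v≤hi : v ≤ seq σ hi
      v≤hi = ≤-pred (subst (v <_) top v<top)
    ... | t , t↦v with window? i j t
    ...   | yes (it , tj) = t , it , tj , t↦v
    ...   | no t∉ with m≤n⇒m<n∨m≡n lo≤v | m≤n⇒m<n∨m≡n (≤-pred (subst (v <_) top v<top))
    ...     | inj₂ lo↦v | _ = contradiction (subst (Window i j) (seq-injective σ-inj (trans lo↦v (sym t↦v))) w-lo) t∉
    ...     | inj₁ _ | inj₂ v≡hi = contradiction (subst (Window i j) (seq-injective σ-inj (trans (sym v≡hi) (sym t↦v))) w-hi) t∉
    ...     | inj₁ lo<v | inj₁ v<hi =
      ⊥-elim (unseparated t∉ w-lo w-hi (subst (seq σ lo <_) (sym t↦v) lo<v) (subst (_< seq σ hi) (sym t↦v) v<hi))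
    bounded : ∀ v → ∃[ p ] (i F.≤ p × p F.≤ j × seq σ p ≡ v) →
              seq σ lo ≤ v × v < seq σ lo + (suc (seq σ hi) ∸ seq σ lo)
    bounded v (p , ip , pj , refl) = lo-min p (ip , pj) , subst (seq σ p <_) (sym top) (s≤s (hi-max p (ip , pj)))

  simple⇒separated : Simple σ → ∀ {i j} → i F.< j → Proper i j → ¬ Unseparated i j
  simple⇒separated simple {i} {j} i<j proper unseparated
    with simple i j (<⇒≤ i<j) (unseparated⇒interval (<⇒≤ i<j) unseparated) | proper
  ... | inj₁ length≡1 | _ = m>n⇒m∸n≢0 i<j (suc-injective length≡1)
  ... | inj₂ length≡m | inj₁ 0<i = <-irrefl length≡m (≤-<-trans (∸-monoʳ-< 0<i (<⇒≤ i<j)) (FP.toℕ<n j))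
  ... | inj₂ length≡m | inj₂ j<m = <-irrefl length≡m (≤-<-trans (s≤s (m∸n≤m (toℕ j) (toℕ i))) j<m)

  properIntervals⇒simple : (∀ {i j} → i F.< j → Proper i j → ¬ IsInterval σ i j) → Simple σ
  properIntervals⇒simple no-proper i j i≤j interval with toℕ i ≟ toℕ j
  ... | yes i≡j = inj₁ (trans (cong (suc ∘ (toℕ j ∸_)) i≡j) (cong suc (n∸n≡0 (toℕ j))))
  ... | no i≢j with toℕ i ≟ 0 | suc (toℕ j) ≟ m
  ...   | yes i≡0 | yes j≡last = inj₂ (trans (cong (suc ∘ (toℕ j ∸_)) i≡0) j≡last)
  ...   | no i≢0 | _ = ⊥-elim (no-proper (≤∧≢⇒< i≤j i≢j) (inj₁ (n≢0⇒n>0 i≢0)) interval)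
  ...   | yes _ | no j≢last = ⊥-elim (no-proper (≤∧≢⇒< i≤j i≢j) (inj₂ (≤∧≢⇒< (FP.toℕ<n j) j≢last)) interval)

  outside-below⇒unseparated : ∀ {i j} → (∀ {t a} → ¬ Window i j t → Window i j a → seq σ t < seq σ a) →
                              Unseparated i j
  outside-below⇒unseparated below t∉ wa _ at _ = <-asym at (below t∉ wa)

  outside-above⇒unseparated : ∀ {i j} → (∀ {t a} → ¬ Window i j t → Window i j a → seq σ a < seq σ t) →
                              Unseparated i j
  outside-above⇒unseparated above t∉ _ wb _ tb = <-asym tb (above t∉ wb)

module ConvexSpans {n : ℕ} (g : Fin n → ℕ) (g-inj : ∀ {a b} → g a ≡ g b → a ≡ b)
                           (no132 : ∀ {a b c} → ¬ Occurs132 g a b c) where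

  Span : ℕ → ℕ → Fin n → Set
  Span lo hi x = lo ≤ toℕ x × toℕ x ≤ hi

  span? : ∀ lo hi → Decidable (Span lo hi)
  span? lo hi x = (lo ≤? toℕ x) ×-dec (toℕ x ≤? hi)

  ConvexSpan : ℕ → ℕ → Set
  ConvexSpan lo hi = ∀ {a b} → Span lo hi a → Span lo hi b →
                     ∀ v → g a < v → v < g b → ∃ λ c → Span lo hi c × g c ≡ v

  AdjacentConsecutive : ℕ → ℕ → Set
  AdjacentConsecutive lo hi = ∃ λ a → ∃ λ b → Span lo hi a × Span lo hi b ×
                              suc (toℕ a) ≡ toℕ b × (g b ≡ suc (g a) ⊎ g a ≡ suc (g b))

  adjacentConsecutive-mono : ∀ {lo hi lo′ hi′} → lo ≤ lo′ → hi′ ≤ hi →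
                             AdjacentConsecutive lo′ hi′ → AdjacentConsecutive lo hi
  adjacentConsecutive-mono lo≤ ≤hi (a , b , (la , ah) , (lb , bh) , adj , consecutive) =
    a , b , (≤-trans lo≤ la , ≤-trans ah ≤hi) , (≤-trans lo≤ lb , ≤-trans bh ≤hi) , adj , consecutive

  consecutive-pair : ∀ lo → suc lo < n → ConvexSpan lo (suc lo) → AdjacentConsecutive lo (suc lo)
  consecutive-pair lo slo<n convex = by-order (<-cmp (g a) (g b))
    where
    a b : Fin n
    a = fromℕ< (<-trans (n<1+n lo) slo<n)
    b = fromℕ< slo<n
    toℕ-a : toℕ a ≡ lo
    toℕ-a = FP.toℕ-fromℕ< _
    toℕ-b : toℕ b ≡ suc lo
    toℕ-b = FP.toℕ-fromℕ< _
    span-a : Span lo (suc lo) a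
    span-a = ≤-reflexive (sym toℕ-a) , ≤-trans (≤-reflexive toℕ-a) (n≤1+n lo)
    span-b : Span lo (suc lo) b
    span-b = ≤-trans (n≤1+n lo) (≤-reflexive (sym toℕ-b)) , ≤-reflexive toℕ-b
    adjacent : suc (toℕ a) ≡ toℕ b
    adjacent = trans (cong suc toℕ-a) (sym toℕ-b)
    only-a-b : ∀ {c} → Span lo (suc lo) c → c ≡ a ⊎ c ≡ b
    only-a-b (lo≤c , c≤slo) with m≤n⇒m<n∨m≡n lo≤c
    ... | inj₂ lo≡c = inj₁ (FP.toℕ-injective (trans (sym lo≡c) (sym toℕ-a)))
    ... | inj₁ lo<c = inj₂ (FP.toℕ-injective (trans (≤-antisym c≤slo lo<c) (sym toℕ-b)))
    close : ∀ x y → (∀ {c} → Span lo (suc lo) c → c ≡ x ⊎ c ≡ y) →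
            Span lo (suc lo) x → Span lo (suc lo) y → g x < g y → g y ≡ suc (g x)
    close x y only span-x span-y xy with m≤n⇒m<n∨m≡n xy
    ... | inj₂ eq = sym eq
    ... | inj₁ gap with convex span-x span-y (suc (g x)) ≤-refl gap
    ...   | c , span-c , c↦ with only span-c
    ...     | inj₁ refl = ⊥-elim (1+n≢n (sym c↦))
    ...     | inj₂ refl = ⊥-elim (<-irrefl (sym c↦) gap)
    by-order : Tri (g a < g b) (g a ≡ g b) (g b < g a) → AdjacentConsecutive lo (suc lo)
    by-order (tri< ab _ _) = a , b , span-a , span-b , adjacent , inj₁ (close a b only-a-b span-a span-b ab)
    by-order (tri≈ _ a≡b _) = contradiction (cong toℕ (g-inj a≡b)) (λ eq → 1+n≢n (trans (sym toℕ-b) (trans (sym eq) toℕ-a)))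
    by-order (tri> _ _ ba) = a , b , span-a , span-b , adjacent , inj₂ (close b a (swap ∘ only-a-b) span-b span-a ba)

  convex-dropMax : ∀ {lo hi lo′ hi′} (t : Fin n) → (∀ x → Span lo hi x → g x ≤ g t) →
                   (∀ {x} → Span lo hi x → x ≢ t → Span lo′ hi′ x) → (∀ {x} → Span lo′ hi′ x → Span lo hi x) →
                   ConvexSpan lo hi → ConvexSpan lo′ hi′
  convex-dropMax t t-max inner outer convex span-a span-b v av vb
    with convex (outer span-a) (outer span-b) v av vb
  ... | c , span-c , c↦v = c , inner span-c c≢t , c↦v
    where
    c≢t : c ≢ _
    c≢t refl = <-irrefl (sym c↦v) (<-≤-trans vb (t-max _ (outer span-b)))

  -- A value of [lo, t] reached beyond the maximum t would form a 132 with t.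
  convex-upToMax : ∀ {lo hi} (t : Fin n) → Span lo hi t → (∀ x → Span lo hi x → g x ≤ g t) →
                   ConvexSpan lo hi → ConvexSpan lo (toℕ t)
  convex-upToMax {lo} {hi} t (_ , t≤hi) t-max convex {a} {b} (la , at) (lb , bt) v av vb
    with convex (la , ≤-trans at t≤hi) (lb , ≤-trans bt t≤hi) v av vb
  ... | c , (lc , ch) , c↦v with toℕ c ≤? toℕ t
  ...   | yes ct = c , (lc , ct) , c↦v
  ...   | no c≰t = ⊥-elim (no132 (a<t , ≰⇒> c≰t , subst (g a <_) (sym c↦v) av , subst (_< g t) (sym c↦v) v<t))
    where
    v<t : v < g t
    v<t = <-≤-trans vb (t-max b (lb , ≤-trans bt t≤hi))
    a<t : a F.< t
    a<t = ≤∧≢⇒< at λ a≡t → <-asym v<t (subst (_< v) (cong g (FP.toℕ-injective a≡t)) av)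

  private
    search : ∀ fuel lo hi → hi ≤ lo + fuel → lo < hi → hi < n → ConvexSpan lo hi → AdjacentConsecutive lo hi
    search zero lo hi bound lo<hi _ _ = contradiction (subst (hi ≤_) (+-identityʳ lo) bound) (<⇒≱ lo<hi)
    search (suc fuel) lo hi bound lo<hi hi<n convex
      with argmax (span? lo hi) g (lo-pos , ≤-reflexive (sym toℕ-lo) , ≤-trans (≤-reflexive toℕ-lo) (<⇒≤ lo<hi))
      where
      lo-pos : Fin n
      lo-pos = fromℕ< (<-trans lo<hi hi<n)
      toℕ-lo : toℕ lo-pos ≡ lo
      toℕ-lo = FP.toℕ-fromℕ< _
    ... | t , span-t@(lo≤t , t≤hi) , t-max with m≤n⇒m<n∨m≡n lo≤t
    ...   | inj₂ lo≡t with suc lo ≟ hi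
    ...     | yes refl = consecutive-pair lo hi<n convex
    ...     | no slo≢hi =
      adjacentConsecutive-mono (n≤1+n lo) ≤-refl
        (search fuel (suc lo) hi (subst (hi ≤_) (+-suc lo fuel) bound) (≤∧≢⇒< lo<hi slo≢hi) hi<n
          (convex-dropMax t t-max
             (λ { (lo≤x , x≤hi) x≢t → ≤∧≢⇒< lo≤x (λ lo≡x → x≢t (FP.toℕ-injective (trans (sym lo≡x) lo≡t))) , x≤hi })
             (λ { (slo≤x , x≤hi) → <⇒≤ slo≤x , x≤hi }) convex))
    search (suc fuel) lo hi bound lo<hi hi<n convex | t , span-t@(lo≤t , t≤hi) , t-max | inj₁ lo<t
      with toℕ t in toℕ-t | convex-upToMax t span-t t-max convex
    ... | suc h | convex-t with lo ≟ h
    ...   | yes refl = adjacentConsecutive-mono ≤-refl (subst (_≤ hi) toℕ-t t≤hi) (consecutive-pair lo (subst (_< n) toℕ-t (FP.toℕ<n t)) convex-t)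
    ...   | no lo≢h =
      adjacentConsecutive-mono ≤-refl (≤-trans (n≤1+n h) st≤hi)
        (search fuel lo h (≤-pred (≤-trans st≤hi (subst (hi ≤_) (+-suc lo fuel) bound))) (≤∧≢⇒< (≤-pred lo<t) lo≢h)
           (<-trans (n<1+n h) (subst (_< n) toℕ-t (FP.toℕ<n t)))
           (convex-dropMax t t-max′
              (λ { (lo≤x , x≤st) x≢t → lo≤x , ≤-pred (≤∧≢⇒< x≤st (λ x≡st → x≢t (FP.toℕ-injective (trans x≡st (sym toℕ-t))))) })
              (λ { (lo≤x , x≤h) → lo≤x , m≤n⇒m≤1+n x≤h }) convex-t))
      where
      st≤hi : suc h ≤ hi
      st≤hi = subst (_≤ hi) toℕ-t t≤hi
      t-max′ : ∀ x → Span lo (suc h) x → g x ≤ g t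
      t-max′ x (lo≤x , x≤st) = t-max x (lo≤x , ≤-trans x≤st st≤hi)

  convex⇒adjacentConsecutive : ∀ {lo hi} → lo < hi → hi < n → ConvexSpan lo hi → AdjacentConsecutive lo hi
  convex⇒adjacentConsecutive {lo} {hi} = search hi lo hi (m≤n+m hi lo)

module Blocks (k n : ℕ) where

  left : Fin k → Fin (k + n)
  left i = i ↑ˡ n

  right : Fin n → Fin (k + n)
  right a = k ↑ʳ a

  toℕ-left : ∀ i → toℕ (left i) ≡ toℕ i
  toℕ-left i = FP.toℕ-↑ˡ i n

  toℕ-right : ∀ a → toℕ (right a) ≡ k + toℕ a
  toℕ-right a = FP.toℕ-↑ʳ k a

  left<k : ∀ i → toℕ (left i) < k
  left<k i = subst (_< k) (sym (toℕ-left i)) (FP.toℕ<n i)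

  k≤right : ∀ a → k ≤ toℕ (right a)
  k≤right a = subst (k ≤_) (sym (toℕ-right a)) (m≤m+n k (toℕ a))

  split : (x : Fin (k + n)) → (∃ λ i → x ≡ left i) ⊎ (∃ λ a → x ≡ right a)
  split x with splitAt k x in eq
  ... | inj₁ i = inj₁ (i , sym (FP.splitAt⁻¹-↑ˡ eq))
  ... | inj₂ a = inj₂ (a , sym (FP.splitAt⁻¹-↑ʳ eq))

  left-view : ∀ x → toℕ x < k → ∃ λ i → x ≡ left i
  left-view x x<k with split x
  ... | inj₁ view = view
  ... | inj₂ (a , refl) = contradiction (k≤right a) (<⇒≱ x<k)

  right-view : ∀ x → k ≤ toℕ x → ∃ λ a → x ≡ right a
  right-view x k≤x with split x
  ... | inj₂ view = view
  ... | inj₁ (i , refl) = contradiction (left<k i) (≤⇒≯ k≤x)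

  right-< : ∀ {a b} → a F.< b → right a F.< right b
  right-< {a} {b} a<b = subst₂ _<_ (sym (toℕ-right a)) (sym (toℕ-right b)) (+-monoʳ-< k a<b)

  right-<⁻¹ : ∀ {a b} → right a F.< right b → a F.< b
  right-<⁻¹ {a} {b} lt = +-cancelˡ-< k _ _ (subst₂ _<_ (toℕ-right a) (toℕ-right b) lt)

  left≢right : ∀ i a → left i ≢ right a
  left≢right i a eq = <⇒≱ (left<k i) (subst (λ x → k ≤ toℕ x) (sym eq) (k≤right a))

module TMember (n k : ℕ) (n≥3 : 3 ≤ n)
  (α : Fin n → Fin n) (α-inj : IsPerm α) (α-132 : Avoids (seq α) p132)
  (top : Fin n) (top≡0 : toℕ top ≡ 0) (α-top : seq α top ≡ n)
  (bot : Fin n) (bot≡last : suc (toℕ bot) ≡ n) (α-bot : seq α bot ≡ n ∸ 1)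
  (r : Fin k → ℕ) (r-range : (j : Fin k) → 2 ≤ r j × r j ≤ n ∸ 1)
  (r-incr : (i j : Fin k) → i F.< j → r i < r j)
  (r-covers : (s : ℕ) → 2 ≤ s → s ≤ n ∸ 1 → (a b : Fin n) →
              seq α a ≡ s ∸ 1 → seq α b ≡ s →
              (suc (toℕ a) ≡ toℕ b ⊎ suc (toℕ b) ≡ toℕ a) → ∃[ j ] r j ≡ s)
  (σ : Fin (k + n) → Fin (k + n)) (σ-inj : IsPerm σ)
  (prefix-incr : (i j : Fin k) → i F.< j → seq σ (i ↑ˡ n) < seq σ (j ↑ˡ n))
  (suffix-iso : OrderIso (λ a → seq σ (k ↑ʳ a)) (seq α))
  (inserted-between : (j : Fin k) (a b : Fin n) → seq α a ≡ r j ∸ 1 → seq α b ≡ r j →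
                      StrictlyBetween (seq σ (j ↑ˡ n)) (seq σ (k ↑ʳ a)) (seq σ (k ↑ʳ b)))
  where

  open Blocks k n
  open Windows σ σ-inj

  s : Fin (k + n) → ℕ
  s = seq σ

  suffix-< : ∀ {a b} → seq α a < seq α b → s (right a) < s (right b)
  suffix-< = from (suffix-iso _ _)

  suffix-<⁻¹ : ∀ {a b} → s (right a) < s (right b) → seq α a < seq α b
  suffix-<⁻¹ = to (suffix-iso _ _)

  suffix-≤ : ∀ {a b} → seq α a ≤ seq α b → s (right a) ≤ s (right b)
  suffix-≤ a≤b = ≮⇒≥ (λ b<a → <⇒≱ (suffix-<⁻¹ b<a) a≤b)

  r-pos : ∀ j → 0 < r j ∸ 1
  r-pos j = ≤-trans (s≤s z≤n) (∸-monoˡ-≤ 1 (proj₁ (r-range j)))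

  r≤n : ∀ j → r j ≤ n
  r≤n j = ≤-trans (proj₂ (r-range j)) (m∸n≤m n 1)

  lower upper : Fin k → Fin n
  lower j = proj₁ (seq-onto α-inj (r j ∸ 1) (r-pos j) (≤-trans (m∸n≤m (r j) 1) (r≤n j)))
  upper j = proj₁ (seq-onto α-inj (r j) (≤-trans z<s (proj₁ (r-range j))) (r≤n j))

  α-lower : ∀ j → seq α (lower j) ≡ r j ∸ 1
  α-lower j = proj₂ (seq-onto α-inj (r j ∸ 1) (r-pos j) (≤-trans (m∸n≤m (r j) 1) (r≤n j)))

  α-upper : ∀ j → seq α (upper j) ≡ r j
  α-upper j = proj₂ (seq-onto α-inj (r j) (≤-trans z<s (proj₁ (r-range j))) (r≤n j))

  inserted-above-below : ∀ j {a b} → seq α a ≡ r j ∸ 1 → seq α b ≡ r j →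
                         s (right a) < s (left j) × s (left j) < s (right b)
  inserted-above-below j {a} {b} α-a α-b with inserted-between j a b α-a α-b
  ... | inj₁ between = between
  ... | inj₂ (b<j , j<a) = contradiction (suffix-< (subst₂ _<_ (sym α-a) (sym α-b) (n∸1<n (≤-trans z<s (proj₁ (r-range j)))))) (<-asym (<-trans b<j j<a))

  inserted : ∀ j → s (right (lower j)) < s (left j) × s (left j) < s (right (upper j))
  inserted j = inserted-above-below j (α-lower j) (α-upper j)

  no-descent132 : ¬ Descent132 s
  no-descent132 (a , b , c , d , a<b , b<a , b<c , c<d , b<d , d<c) with split b
  ... | inj₁ (i , refl) with left-view a (<-trans a<b (left<k i))
  ...   | i′ , refl = <-asym b<a (prefix-incr i′ i (subst₂ _<_ (toℕ-left i′) (toℕ-left i) a<b))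
  no-descent132 (a , b , c , d , a<b , b<a , b<c , c<d , b<d , d<c) | inj₂ (b′ , refl)
    with right-view c (≤-trans (k≤right b′) (<⇒≤ b<c)) | right-view d (≤-trans (k≤right b′) (<⇒≤ (<-trans b<c c<d)))
  ... | c′ , refl | d′ , refl =
    α-132 (contains-132 (seq α) (right-<⁻¹ b<c , right-<⁻¹ c<d , suffix-<⁻¹ b<d , suffix-<⁻¹ d<c))

  avoids : InAv σ
  avoids = no-descent132 ∘ descent132 s p2143 <-literal <-literal <-literal
         , no-descent132 ∘ descent132 s p3142 <-literal <-literal <-literal
         , no-descent132 ∘ descent132 s p4132 <-literal <-literal <-literal

  top-max : s (right bot) < s (right top)
  top-max = suffix-< (subst₂ _<_ (sym α-bot) (sym α-top) (n∸1<n (≤-trans z<s n≥3)))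

  below-bot : ∀ x → toℕ x ≢ k → x ≢ right bot → s x < s (right bot)
  below-bot x x≢k x≢bot with split x
  ... | inj₁ (j , refl) =
    <-≤-trans (proj₂ (inserted j)) (suffix-≤ (subst₂ _≤_ (sym (α-upper j)) (sym α-bot) (proj₂ (r-range j))))
  ... | inj₂ (a , refl) = suffix-< (subst (seq α a <_) (sym α-bot) (≤∧≢⇒< (<⇒≤∸1 (≤∧≢⇒< (seq≤ α a) a≢top)) a≢bot))
    where
    a≢top : seq α a ≢ n
    a≢top α-a = x≢k (trans (toℕ-right a) (trans (cong (k +_) (trans (cong toℕ (seq-injective α-inj (trans α-a (sym α-top)))) top≡0)) (+-identityʳ k)))
    a≢bot : seq α a ≢ n ∸ 1
    a≢bot α-a = x≢bot (cong right (seq-injective α-inj (trans α-a (sym α-bot))))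

  prefix-window-separated : ∀ {i j} → i F.< j → toℕ j < k → ¬ IsInterval σ i j
  prefix-window-separated {i} {j} i<j j<k interval with left-view i (<-trans i<j j<k) | left-view j j<k
  ... | i′ , refl | j′ , refl = <⇒≱ (≤-<-trans (proj₂ upper∈window) j<k) (k≤right (upper i′))
    where
    r-i′<r-j′ : r i′ < r j′
    r-i′<r-j′ = r-incr i′ j′ (subst₂ _<_ (toℕ-left i′) (toℕ-left j′) i<j)
    upper≤lower : s (right (upper i′)) ≤ s (right (lower j′))
    upper≤lower = suffix-≤ (subst₂ _≤_ (sym (α-upper i′)) (sym (α-lower j′)) (<⇒≤∸1 r-i′<r-j′))
    upper∈window : Window (left i′) (left j′) (right (upper i′))
    upper∈window = interval-closed interval (start∈window (<⇒≤ i<j)) (end∈window (<⇒≤ i<j))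
                     (proj₂ (inserted i′)) (≤-<-trans upper≤lower (proj₁ (inserted j′)))

  straddling-window-separated : ∀ {i j} → toℕ i ≤ k → k ≤ toℕ j → i F.< j → Proper i j → ¬ IsInterval σ i j
  straddling-window-separated {i} {j} i≤k k≤j i<j proper interval with suc (toℕ j) ≟ k + n | proper
  ... | yes j-last | inj₂ j-not-last = <-irrefl j-last j-not-last
  ... | yes j-last | inj₁ 0<i = <⇒≱ 0<i (subst (toℕ i ≤_) (trans (toℕ-left first) (FP.toℕ-fromℕ< _)) (proj₁ first∈window))
    where
    first : Fin k
    first = fromℕ< (<-≤-trans 0<i i≤k)
    suffix∈window : ∀ a → Window i j (right a)
    suffix∈window a = ≤-trans i≤k (k≤right a) , ≤-pred (subst (suc (toℕ (right a)) ≤_) (sym j-last) (FP.toℕ<n (right a)))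
    first∈window : Window i j (left first)
    first∈window = interval-closed interval (suffix∈window _) (suffix∈window _) (proj₁ (inserted first)) (proj₂ (inserted first))
  ... | no j-not-last | _ = <⇒≱ j<bot (proj₂ bot∈window)
    where
    j<bot : toℕ j < toℕ (right bot)
    j<bot = ≤-pred (subst (suc (suc (toℕ j)) ≤_) (sym bot-last) (≤∧≢⇒< (FP.toℕ<n j) j-not-last))
      where
      bot-last : suc (toℕ (right bot)) ≡ k + n
      bot-last = trans (cong suc (toℕ-right bot)) (trans (sym (+-suc k (toℕ bot))) (cong (k +_) bot≡last))
    top∈window : Window i j (right top)
    top∈window = subst (toℕ i ≤_) (sym top-at-k) i≤k , subst (_≤ toℕ j) (sym top-at-k) k≤j
      where
      top-at-k : toℕ (right top) ≡ k
      top-at-k = trans (toℕ-right top) (trans (cong (k +_) top≡0) (+-identityʳ k))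
    other : ∃ λ q → Window i j q × toℕ q ≢ k
    other with toℕ i ≟ k
    ... | yes i≡k = j , end∈window (<⇒≤ i<j) , λ j≡k → <-irrefl (trans i≡k (sym j≡k)) i<j
    ... | no i≢k = i , start∈window (<⇒≤ i<j) , i≢k
    bot∈window : Window i j (right bot)
    bot∈window with other
    ... | q , q∈window , q≢k =
      interval-closed interval q∈window top∈window (below-bot q q≢k q≢bot) top-max
      where
      q≢bot : q ≢ right bot
      q≢bot refl = <⇒≱ j<bot (proj₂ q∈window)

  open ConvexSpans (seq α) (seq-injective α-inj) (λ occ → α-132 (contains-132 (seq α) occ))

  module SuffixWindow {i j : Fin (k + n)} (k<i : k < toℕ i) (i<j : i F.< j) where

    lo hi : ℕ
    lo = toℕ i ∸ k
    hi = toℕ j ∸ k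

    k+lo : k + lo ≡ toℕ i
    k+lo = m+[n∸m]≡n (<⇒≤ k<i)

    k+hi : k + hi ≡ toℕ j
    k+hi = m+[n∸m]≡n (≤-trans (<⇒≤ k<i) (<⇒≤ i<j))

    lo<hi : lo < hi
    lo<hi = ∸-monoˡ-< i<j (<⇒≤ k<i)

    hi<n : hi < n
    hi<n = +-cancelˡ-< k _ _ (subst (_< k + n) (sym k+hi) (FP.toℕ<n j))

    span⇒window : ∀ {a} → Span lo hi a → Window i j (right a)
    span⇒window {a} (lo≤a , a≤hi) =
        subst₂ _≤_ k+lo (sym (toℕ-right a)) (+-monoʳ-≤ k lo≤a)
      , subst₂ _≤_ (sym (toℕ-right a)) k+hi (+-monoʳ-≤ k a≤hi)

    window⇒span : ∀ {a} → Window i j (right a) → Span lo hi a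
    window⇒span {a} (i≤a , a≤j) =
        m≤n+o⇒m∸n≤o (toℕ i) k (subst (toℕ i ≤_) (toℕ-right a) i≤a)
      , +-cancelˡ-≤ k _ _ (subst₂ _≤_ (toℕ-right a) (sym k+hi) a≤j)

    interval⇒convex : IsInterval σ i j → ConvexSpan lo hi
    interval⇒convex interval {a} {b} span-a span-b v av vb
      with seq-onto α-inj v (≤-<-trans z≤n av) (≤-trans (<⇒≤ vb) (seq≤ α b))
    ... | c , α-c = c , window⇒span (interval-closed interval (span⇒window span-a) (span⇒window span-b)
                                       (suffix-< (subst (_ <_) (sym α-c) av)) (suffix-< (subst (_< _) (sym α-c) vb))) , α-c

    below-top : ∀ {a} → Span lo hi a → seq α a ≤ n ∸ 1
    below-top {a} (lo≤a , _) = <⇒≤∸1 (≤∧≢⇒< (seq≤ α a) λ α-a →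
      <⇒≱ (≤-trans (m<n⇒0<n∸m k<i) lo≤a) (≤-reflexive (trans (cong toℕ (seq-injective α-inj (trans α-a (sym α-top)))) top≡0)))

  -- Since α avoids 132, the window holds two neighbours with consecutive values,
  -- and the entry inserted between these values lies in the prefix.
  suffix-window-separated : ∀ {i j} → k < toℕ i → i F.< j → ¬ IsInterval σ i j
  suffix-window-separated {i} {j} k<i i<j interval = separated (convex⇒adjacentConsecutive lo<hi hi<n (interval⇒convex interval))
    where
    open SuffixWindow k<i i<j
    separate : ∀ {a b} → Span lo hi a → Span lo hi b → (suc (toℕ a) ≡ toℕ b ⊎ suc (toℕ b) ≡ toℕ a) →
               seq α b ≡ suc (seq α a) → ⊥
    separate {a} {b} span-a span-b adjacent b↦ with r-covers (seq α b) (subst (2 ≤_) (sym b↦) (s≤s (s≤s z≤n)))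
                                                     (below-top span-b) a b (cong (_∸ 1) (sym b↦)) refl adjacent
    ... | j₀ , r-j₀ with inserted-above-below j₀ (trans (cong (_∸ 1) (sym b↦)) (cong (_∸ 1) (sym r-j₀))) (sym r-j₀)
    ...   | a<j₀ , j₀<b = <⇒≱ (<-trans (left<k j₀) k<i)
                             (proj₁ (interval-closed interval (span⇒window span-a) (span⇒window span-b) a<j₀ j₀<b))
    separated : AdjacentConsecutive lo hi → ⊥
    separated (a , b , span-a , span-b , adjacent , inj₁ b↦) = separate span-a span-b (inj₁ adjacent) b↦
    separated (a , b , span-a , span-b , adjacent , inj₂ a↦) = separate span-b span-a (inj₂ adjacent) a↦

  simple : Simple σ
  simple = properIntervals⇒simple λ {i} {j} i<j proper → by-position i<j proper
    where
    by-position : ∀ {i j} → i F.< j → Proper i j → ¬ IsInterval σ i j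
    by-position {i} {j} i<j proper with toℕ j <? k | k <? toℕ i
    ... | yes j<k | _ = prefix-window-separated i<j j<k
    ... | no _ | yes k<i = suffix-window-separated k<i i<j
    ... | no j≮k | no i≮k = straddling-window-separated (≮⇒≥ i≮k) (≮⇒≥ j≮k) i<j proper

module Standardisation {N : ℕ} (g : Fin N → ℕ) (g-inj : ∀ {a b} → g a ≡ g b → a ≡ b) where

  rank : Fin N → ℕ
  rank a = count (λ c → g c ≤? g a)

  rank-pos : ∀ a → 0 < rank a
  rank-pos a = count-pos (λ c → g c ≤? g a) a ≤-refl

  rank-< : ∀ {a b} → g a < g b → rank a < rank b
  rank-< {a} {b} a<b = count-strictMono (λ c → g c ≤? g a) (λ c → g c ≤? g b) (λ c c≤a → ≤-trans c≤a (<⇒≤ a<b)) b ≤-refl (<⇒≱ a<b)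

  rank-≤ : ∀ {a b} → g a ≤ g b → rank a ≤ rank b
  rank-≤ {a} {b} a≤b = count-mono (λ c → g c ≤? g a) (λ c → g c ≤? g b) (λ c c≤a → ≤-trans c≤a a≤b)

  standardise : Fin N → Fin N
  standardise a = fromℕ< (<-≤-trans (n∸1<n (rank-pos a)) (count≤n _))

  seq-standardise : ∀ a → seq standardise a ≡ rank a
  seq-standardise a = trans (cong suc (FP.toℕ-fromℕ< _)) (suc[n∸1]≡n (rank-pos a))

  standardise-orderIso : OrderIso g (seq standardise)
  standardise-orderIso a b = mk⇔
    (λ a<b → subst₂ _<_ (sym (seq-standardise a)) (sym (seq-standardise b)) (rank-< a<b))
    (λ a<b → ≰⇒> (λ b≤a → <⇒≱ (subst₂ _<_ (seq-standardise a) (seq-standardise b) a<b) (rank-≤ b≤a)))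

  standardise-injective : IsPerm standardise
  standardise-injective {a} {b} eq with <-cmp (g a) (g b)
  ... | tri< a<b _ _ = contradiction (cong (suc ∘ toℕ) eq) (<⇒≢ (to (standardise-orderIso a b) a<b))
  ... | tri≈ _ a≡b _ = g-inj a≡b
  ... | tri> _ _ b<a = contradiction (cong (suc ∘ toℕ) (sym eq)) (<⇒≢ (to (standardise-orderIso b a) b<a))

module SimpleAvoider (k n′ : ℕ) (σ : Fin (k + suc n′) → Fin (k + suc n′)) (σ-inj : IsPerm σ)
  (σ-simple : Simple σ) (σ-avoids : InAv σ) (m≥3 : 3 ≤ k + suc n′)
  (peak-max : ∀ x → seq σ x ≤ seq σ (k ↑ʳ F.zero)) where

  N M : ℕ
  N = suc n′
  M = k + N

  open Blocks k N
  open Windows σ σ-inj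

  s : Fin M → ℕ
  s = seq σ

  peak : Fin M
  peak = right 0F

  toℕ-peak : toℕ peak ≡ k
  toℕ-peak = trans (toℕ-right 0F) (+-identityʳ k)

  at-peak : ∀ {x : Fin M} → toℕ x ≡ k → x ≡ peak
  at-peak x≡k = FP.toℕ-injective (trans x≡k (sym toℕ-peak))

  below-peak : ∀ x → toℕ x ≢ k → s x < s peak
  below-peak x x≢k = ≤∧≢⇒< (peak-max x) (λ eq → x≢k (trans (cong toℕ (seq-injective σ-inj eq)) toℕ-peak))

  separated : ∀ {i j} → i F.< j → Proper i j → ¬ Unseparated i j
  separated = simple⇒separated σ-simple

  peak-not-last : n′ ≢ 0
  peak-not-last refl = separated first<before (inj₂ before-peak<M) (outside-above⇒unseparated above)
    where
    2≤k : 2 ≤ k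
    2≤k = ≤-pred (subst (3 ≤_) (+-comm k 1) m≥3)
    k∸1<M : k ∸ 1 < M
    k∸1<M = <-≤-trans (n∸1<n (≤-trans z<s 2≤k)) (m≤m+n k 1)
    first before : Fin M
    first = fromℕ< (≤-<-trans z≤n k∸1<M)
    before = fromℕ< k∸1<M
    first<before : first F.< before
    first<before = subst₂ _<_ (sym (FP.toℕ-fromℕ< _)) (sym (FP.toℕ-fromℕ< _)) (∸-monoˡ-≤ 1 2≤k)
    before-peak<M : suc (toℕ before) < M
    before-peak<M = subst (λ x → suc x < M) (sym (FP.toℕ-fromℕ< _))
                      (subst (_< M) (sym (suc[n∸1]≡n (≤-trans z<s 2≤k))) (subst (k <_) (+-comm 1 k) ≤-refl))
    above : ∀ {t a} → ¬ Window first before t → Window first before a → s a < s t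
    above {t} {a} t∉ (_ , a≤before) with outside-window t∉
    ... | inj₁ t<first = contradiction (subst (_≤ toℕ t) (sym (FP.toℕ-fromℕ< _)) z≤n) (<⇒≱ t<first)
    ... | inj₂ before<t = subst (λ x → s a < s x) (sym (at-peak t≡k)) (below-peak a a≢k)
      where
      t≡k : toℕ t ≡ k
      t≡k = ≤-antisym (≤-pred (subst (toℕ t <_) (+-comm k 1) (FP.toℕ<n t)))
                      (subst (_≤ toℕ t) (trans (cong suc (FP.toℕ-fromℕ< _)) (suc[n∸1]≡n (≤-trans z<s 2≤k))) before<t)
      a≢k : toℕ a ≢ k
      a≢k a≡k = <⇒≱ (n∸1<n (≤-trans z<s 2≤k)) (subst (_≤ k ∸ 1) a≡k (subst (toℕ a ≤_) (FP.toℕ-fromℕ< _) a≤before))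

  n′≥1 : 1 ≤ n′
  n′≥1 = n≢0⇒n>0 peak-not-last

  after-peak : Fin M
  after-peak = right 1F′
    where
    1F′ : Fin N
    1F′ = fromℕ< (s≤s n′≥1)

  k<after-peak : k < toℕ after-peak
  k<after-peak = subst (k <_) (sym (trans (toℕ-right _) (cong (k +_) (FP.toℕ-fromℕ< (s≤s n′≥1))))) (m<m+n k z<s)

  peak+1<M : suc k < M
  peak+1<M = ≤-<-trans k<after-peak (FP.toℕ<n after-peak)

  before-peak : ∀ {x : Fin M} → toℕ x < k → x F.< peak
  before-peak {x} x<k = subst (toℕ x <_) (sym toℕ-peak) x<k

  after-peak< : ∀ {x : Fin M} → k < toℕ x → peak F.< x
  after-peak< {x} k<x = subst (_< toℕ x) (sym toℕ-peak) k<x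

  -- With the peak, such a triple would form a 3142 or a 2143.
  descent-above-suffix : ∀ {a b c : Fin M} → a F.< b → toℕ b < k → k < toℕ c → s b < s a → s c < s b
  descent-above-suffix {a} {b} {c} a<b b<k k<c b<a with <-cmp (s c) (s b)
  ... | tri< c<b _ _ = c<b
  ... | tri≈ _ c≡b _ = contradiction (cong toℕ (seq-injective σ-inj c≡b)) (λ eq → <-asym b<k (subst (k <_) eq k<c))
  ... | tri> _ _ b<c with <-cmp (s c) (s a)
  ...   | tri< c<a _ _ = ⊥-elim (proj₁ (proj₂ σ-avoids)
    (contains-3142 s a<b (before-peak b<k) (after-peak< k<c) b<c c<a (below-peak a (<⇒≢ (<-trans a<b b<k)))))
  ...   | tri≈ _ c≡a _ = contradiction (cong toℕ (seq-injective σ-inj c≡a)) (λ eq → <-asym (<-trans a<b b<k) (subst (k <_) eq k<c))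
  ...   | tri> _ _ a<c = ⊥-elim (proj₁ σ-avoids
    (contains-2143 s a<b (before-peak b<k) (after-peak< k<c) b<a a<c (below-peak c (>⇒≢ k<c))))

  largest-after-peak : Σ (Fin M) λ w → k < toℕ w × (∀ x → k < toℕ x → s x ≤ s w)
  largest-after-peak = argmax (λ x → k <? toℕ x) s (after-peak , k<after-peak)

  -- With w the largest entry after the peak and h the first entry above w,
  -- the block from h to the peak would be an interval.
  no-prefix-descent : ∀ {a b : Fin M} → a F.< b → toℕ b < k → ¬ (s b < s a)
  no-prefix-descent {a} {b} a<b b<k b<a with largest-after-peak
  ... | w , k<w , w-max with argmin (λ y → s w <? s y) toℕ (a , w<a)
    where
    w<a : s w < s a
    w<a = <-trans (descent-above-suffix a<b b<k k<w b<a) b<a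
  ... | h , w<h , h-first = separated h<peak (inj₂ (subst (λ x → suc x < M) (sym toℕ-peak) peak+1<M)) (outside-below⇒unseparated below)
    where
    h<peak : h F.< peak
    h<peak = ≤-<-trans (h-first a (<-trans (descent-above-suffix a<b b<k k<w b<a) b<a)) (subst (toℕ a <_) (sym toℕ-peak) (<-trans a<b b<k))
    above-w : ∀ {y} → Window h peak y → s w < s y
    above-w {y} (h≤y , y≤peak) with toℕ y ≟ k
    ... | yes y≡k = subst (λ x → s w < s x) (sym (at-peak y≡k)) (below-peak w (>⇒≢ k<w))
    ... | no y≢k with s w <? s y
    ...   | yes w<y = w<y
    ...   | no w≮y with m≤n⇒m<n∨m≡n h≤y
    ...     | inj₂ h≡y = contradiction (subst (λ x → s w < s x) (FP.toℕ-injective h≡y) w<h) w≮y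
    ...     | inj₁ h<y = contradiction (descent-above-suffix h<y (≤∧≢⇒< (subst (toℕ y ≤_) toℕ-peak y≤peak) y≢k) k<w
                                          (≤-<-trans (≮⇒≥ w≮y) w<h)) w≮y
    below : ∀ {t a} → ¬ Window h peak t → Window h peak a → s t < s a
    below {t} t∉ a∈ with outside-window t∉
    ... | inj₁ t<h = ≤-<-trans (≮⇒≥ (λ w<t → <⇒≱ t<h (h-first t w<t))) (above-w a∈)
    ... | inj₂ peak<t = ≤-<-trans (w-max t (subst (_< toℕ t) toℕ-peak peak<t)) (above-w a∈)

  prefix-< : ∀ {a b : Fin M} → a F.< b → toℕ b < k → s a < s b
  prefix-< {a} {b} a<b b<k with <-cmp (s a) (s b)
  ... | tri< a<b′ _ _ = a<b′
  ... | tri≈ _ a≡b _ = contradiction (cong toℕ (seq-injective σ-inj a≡b)) (<⇒≢ a<b)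
  ... | tri> _ _ b<a = contradiction b<a (no-prefix-descent a<b b<k)

  prefix-≤ : ∀ {a b : Fin M} → a F.≤ b → toℕ b < k → s a ≤ s b
  prefix-≤ a≤b b<k with m≤n⇒m<n∨m≡n a≤b
  ... | inj₁ a<b = <⇒≤ (prefix-< a<b b<k)
  ... | inj₂ a≡b = ≤-reflexive (cong s (FP.toℕ-injective a≡b))

  -- With the peak in front, a 132 here would form a 4132.
  suffix-no132 : ∀ {a b c : Fin M} → k ≤ toℕ a → ¬ Occurs132 s a b c
  suffix-no132 {a} {b} {c} k≤a (a<b , b<c , a<c , c<b) with toℕ a ≟ k
  ... | yes a≡k = <⇒≱ (<-trans a<c c<b) (subst (λ x → s b ≤ s x) (sym (at-peak a≡k)) (peak-max b))
  ... | no a≢k = proj₂ (proj₂ σ-avoids)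
                   (contains-4132 s (subst (_< toℕ a) (sym toℕ-peak) (≤∧≢⇒< k≤a (a≢k ∘ sym))) a<b b<c a<c c<b
                     (below-peak b (λ b≡k → <-irrefl (sym b≡k) (≤-<-trans k≤a a<b))))

  last : Fin M
  last = right (F.fromℕ n′)

  toℕ-last : toℕ last ≡ k + n′
  toℕ-last = trans (toℕ-right _) (cong (k +_) (FP.toℕ-fromℕ n′))

  last-is-last : suc (toℕ last) ≡ M
  last-is-last = trans (cong suc toℕ-last) (sym (+-suc k n′))

  ≤last : ∀ x → x F.≤ last
  ≤last x = ≤-pred (subst (suc (toℕ x) ≤_) (sym last-is-last) (FP.toℕ<n x))

  last≢k : toℕ last ≢ k
  last≢k last≡k = <-irrefl (sym (trans (sym toℕ-last) last≡k)) (m<m+n k n′≥1)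

  runner-up : Σ (Fin M) λ q → toℕ q ≢ k × (∀ x → toℕ x ≢ k → s x ≤ s q)
  runner-up = argmax (λ x → ¬? (toℕ x ≟ k)) s (last , last≢k)

  q : Fin M
  q = proj₁ runner-up

  q≢k : toℕ q ≢ k
  q≢k = proj₁ (proj₂ runner-up)

  below-q : ∀ x → toℕ x ≢ k → x ≢ q → s x < s q
  below-q x x≢k x≢q = ≤∧≢⇒< (proj₂ (proj₂ runner-up) x x≢k) (x≢q ∘ seq-injective σ-inj)

  -- Otherwise the block from q to the peak would be an interval.
  runner-up-after-peak : k < toℕ q
  runner-up-after-peak with <-cmp (toℕ q) k
  ... | tri> _ _ k<q = k<q
  ... | tri≈ _ q≡k _ = contradiction q≡k q≢k
  ... | tri< q<k _ _ = ⊥-elim (separated (before-peak q<k) (inj₂ (subst (λ x → suc x < M) (sym toℕ-peak) peak+1<M))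
                                 (outside-below⇒unseparated below))
    where
    below : ∀ {t a} → ¬ Window q peak t → Window q peak a → s t < s a
    below {t} {a} t∉ (q≤a , a≤peak) = <-≤-trans (below-q t t≢k t≢q) q≤a′
      where
      t≢k : toℕ t ≢ k
      t≢k t≡k = t∉ (subst (toℕ q ≤_) (sym t≡k) (<⇒≤ q<k) , ≤-reflexive (trans t≡k (sym toℕ-peak)))
      t≢q : t ≢ q
      t≢q refl = t∉ (≤-refl , <⇒≤ (before-peak q<k))
      q≤a′ : s q ≤ s a
      q≤a′ with toℕ a ≟ k
      ... | yes a≡k = subst (λ x → s q ≤ s x) (sym (at-peak a≡k)) (peak-max q)
      ... | no a≢k = prefix-≤ q≤a (≤∧≢⇒< (subst (toℕ a ≤_) toℕ-peak a≤peak) a≢k)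

  -- Otherwise, with w the largest entry after q and h the first entry above w,
  -- the block from h to q would be an interval.
  runner-up-last : q ≡ last
  runner-up-last with q FP.≟ last
  ... | yes q≡last = q≡last
  ... | no q≢last with argmax (λ x → toℕ q <? toℕ x) s (last , q<last)
    where
    q<last : q F.< last
    q<last = ≤∧≢⇒< (≤last q) (q≢last ∘ FP.toℕ-injective)
  ... | w , q<w , w-max with argmin (λ y → s w <? s y) toℕ (peak , below-peak w (>⇒≢ (<-trans runner-up-after-peak q<w)))
  ... | h , w<h , h-first =
    ⊥-elim (separated (≤-<-trans h≤k runner-up-after-peak)
                      (inj₂ (subst (suc (toℕ q) <_) last-is-last (s≤s (≤∧≢⇒< (≤last q) (q≢last ∘ FP.toℕ-injective)))))
                      (outside-below⇒unseparated below))
    where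
    w≢k : toℕ w ≢ k
    w≢k = >⇒≢ (<-trans runner-up-after-peak q<w)
    h≤k : toℕ h ≤ k
    h≤k = subst (toℕ h ≤_) toℕ-peak (h-first peak (below-peak w w≢k))
    w<q : s w < s q
    w<q = below-q w w≢k (λ w≡q → <-irrefl (cong toℕ (sym w≡q)) q<w)
    above-w : ∀ {y} → Window h q y → s w < s y
    above-w {y} (h≤y , y≤q) with <-cmp (toℕ y) k
    ... | tri< y<k _ _ = <-≤-trans w<h (prefix-≤ h≤y y<k)
    ... | tri≈ _ y≡k _ = subst (λ x → s w < s x) (sym (at-peak y≡k)) (below-peak w w≢k)
    ... | tri> _ _ k<y with toℕ y ≟ toℕ q
    ...   | yes y≡q = subst (λ x → s w < s x) (sym (FP.toℕ-injective y≡q)) w<q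
    ...   | no y≢q with <-cmp (s y) (s w)
    ...     | tri> _ _ w<y = w<y
    ...     | tri≈ _ y≡w _ = contradiction (cong toℕ (seq-injective σ-inj y≡w)) (<⇒≢ (≤-<-trans y≤q q<w))
    ...     | tri< y<w _ _ = ⊥-elim (suffix-no132 (<⇒≤ k<y) (≤∧≢⇒< y≤q y≢q , q<w , y<w , w<q))
    below : ∀ {t a} → ¬ Window h q t → Window h q a → s t < s a
    below t∉ a∈ with outside-window t∉
    ... | inj₁ t<h = ≤-<-trans (≮⇒≥ (λ w<t → <⇒≱ t<h (h-first _ w<t))) (above-w a∈)
    ... | inj₂ q<t = ≤-<-trans (w-max _ q<t) (above-w a∈)

  below-last : ∀ y → toℕ y ≢ k → y ≢ last → s y < s last
  below-last y y≢k y≢last = subst (λ x → s y < s x) runner-up-last (below-q y y≢k (λ y≡q → y≢last (trans y≡q runner-up-last)))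

  -- Otherwise the peak and the last entry would form an interval.
  n′≢1 : n′ ≢ 1
  n′≢1 refl = separated peak<last (inj₁ (subst (0 <_) (sym toℕ-peak) 0<k)) (outside-below⇒unseparated below)
    where
    0<k : 0 < k
    0<k = ≤-pred (≤-pred (subst (3 ≤_) (+-comm k 2) m≥3))
    peak<last : peak F.< last
    peak<last = subst₂ _<_ (sym toℕ-peak) (sym toℕ-last) (m<m+n k z<s)
    below : ∀ {t a} → ¬ Window peak last t → Window peak last a → s t < s a
    below {t} {a} t∉ (peak≤a , _) = <-≤-trans (below-last t t≢k t≢last) last≤a
      where
      t≢k : toℕ t ≢ k
      t≢k t≡k = t∉ (≤-reflexive (trans toℕ-peak (sym t≡k)) , ≤last t)
      t≢last : t ≢ last
      t≢last refl = t∉ (<⇒≤ peak<last , ≤-refl)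
      last≤a : s last ≤ s a
      last≤a with toℕ a ≟ k
      ... | yes a≡k = subst (λ x → s last ≤ s x) (sym (at-peak a≡k)) (peak-max last)
      ... | no a≢k = ≤-reflexive (cong s (sym (FP.toℕ-injective
                       (≤-antisym (≤last a) (subst (_≤ toℕ a) (sym (trans toℕ-last (+-comm k 1)))
                                                 (≤∧≢⇒< (subst (_≤ toℕ a) toℕ-peak peak≤a) (a≢k ∘ sym)))))))

  n′≥2 : 2 ≤ n′
  n′≥2 = ≤∧≢⇒< n′≥1 (n′≢1 ∘ sym)

  -- Otherwise the first entry would lie below all others, making the rest an interval.
  prefix-above-suffix : (j : Fin k) → ∃ λ c → s (right c) < s (left j)
  prefix-above-suffix j with FP.any? (λ c → s (right c) <? s (left j))
  ... | yes below-j = below-j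
  ... | no none = ⊥-elim (separated second<last (inj₁ (subst (0 <_) (sym toℕ-second) z<s)) (outside-below⇒unseparated below))
    where
    second : Fin M
    second = fromℕ< (<-≤-trans (s<s z<s) m≥3)
    toℕ-second : toℕ second ≡ 1
    toℕ-second = FP.toℕ-fromℕ< _
    second<last : second F.< last
    second<last = subst₂ _<_ (sym toℕ-second) (sym toℕ-last) (≤-trans n′≥2 (m≤n+m n′ k))
    j-below-suffix : ∀ c → s (left j) < s (right c)
    j-below-suffix c = ≤∧≢⇒< (≮⇒≥ (λ c<j → none (c , c<j))) (left≢right j c ∘ seq-injective σ-inj)
    below : ∀ {t a} → ¬ Window second last t → Window second last a → s t < s a
    below {t} {a} t∉ (second≤a , _) with outside-window t∉
    ... | inj₂ last<t = contradiction (≤last t) (<⇒≱ last<t)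
    ... | inj₁ t<second with split a
    ...   | inj₁ (i , refl) = prefix-< (<-≤-trans t<second second≤a) (left<k i)
    ...   | inj₂ (c , refl) = ≤-<-trans (prefix-≤ t≤j (left<k j)) (j-below-suffix c)
      where
      t≤j : t F.≤ left j
      t≤j = subst (_≤ toℕ (left j)) (sym (n<1⇒n≡0 (subst (toℕ t <_) toℕ-second t<second))) z≤n

  adjacent-separated : ∀ {x y : Fin M} → suc (toℕ x) ≡ toℕ y →
                       ¬ (∀ t → ¬ Window x y t → ¬ StrictlyBetween (s t) (s x) (s y))
  adjacent-separated {x} {y} adjacent no-between =
    separated x<y proper λ {t} t∉ a∈ b∈ at tb → no-between t t∉ (between (only-ends a∈) (only-ends b∈) at tb)
    where
    x<y : x F.< y
    x<y = subst (toℕ x <_) adjacent ≤-refl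
    proper : Proper x y
    proper with toℕ x ≟ 0
    ... | no x≢0 = inj₁ (n≢0⇒n>0 x≢0)
    ... | yes x≡0 = inj₂ (subst (λ z → suc z < M) (trans (cong suc (sym x≡0)) adjacent) m≥3)
    only-ends : ∀ {a} → Window x y a → a ≡ x ⊎ a ≡ y
    only-ends {a} (x≤a , a≤y) with m≤n⇒m<n∨m≡n x≤a
    ... | inj₂ x≡a = inj₁ (FP.toℕ-injective (sym x≡a))
    ... | inj₁ x<a = inj₂ (FP.toℕ-injective (≤-antisym a≤y (subst (_≤ toℕ a) adjacent x<a)))
    between : ∀ {a b t} → a ≡ x ⊎ a ≡ y → b ≡ x ⊎ b ≡ y → s a < s t → s t < s b → StrictlyBetween (s t) (s x) (s y)
    between (inj₁ refl) (inj₂ refl) at tb = inj₁ (at , tb)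
    between (inj₂ refl) (inj₁ refl) at tb = inj₂ (at , tb)
    between (inj₁ refl) (inj₁ refl) at tb = ⊥-elim (<-asym at tb)
    between (inj₂ refl) (inj₂ refl) at tb = ⊥-elim (<-asym at tb)

  -- Neighbours in the increasing prefix can only be separated by a suffix entry.
  consecutive-prefix-separated : (i j : Fin k) → suc (toℕ i) ≡ toℕ j →
                                 ∃ λ c → s (left i) < s (right c) × s (right c) < s (left j)
  consecutive-prefix-separated i j adjacent with FP.any? (λ c → (s (left i) <? s (right c)) ×-dec (s (right c) <? s (left j)))
  ... | yes separating = separating
  ... | no none = ⊥-elim (adjacent-separated adjacent′ not-between)
    where
    adjacent′ : suc (toℕ (left i)) ≡ toℕ (left j)
    adjacent′ = trans (cong suc (toℕ-left i)) (trans adjacent (sym (toℕ-left j)))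
    i<j : s (left i) < s (left j)
    i<j = prefix-< (subst (toℕ (left i) <_) adjacent′ ≤-refl) (left<k j)
    not-between : ∀ t → ¬ Window (left i) (left j) t → ¬ StrictlyBetween (s t) (s (left i)) (s (left j))
    not-between t t∉ (inj₂ (j<t , t<i)) = <-asym i<j (<-trans j<t t<i)
    not-between t t∉ (inj₁ (i<t , t<j)) with split t | outside-window t∉
    ... | inj₂ (c , refl) | _ = none (c , i<t , t<j)
    ... | inj₁ (i′ , refl) | inj₁ t<i = <-asym i<t (prefix-< t<i (left<k i))
    ... | inj₁ (i′ , refl) | inj₂ j<t = <-asym t<j (prefix-< j<t (left<k i′))

  consecutive-suffix-separated : ∀ a b → (suc (toℕ a) ≡ toℕ b ⊎ suc (toℕ b) ≡ toℕ a) →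
                                 (∀ c → ¬ (s (right a) < s (right c) × s (right c) < s (right b))) →
                                 s (right a) < s (right b) →
                                 ∃ λ j → s (right a) < s (left j) × s (left j) < s (right b)
  consecutive-suffix-separated a b adjacent no-suffix-between a<b
    with FP.any? (λ j → (s (right a) <? s (left j)) ×-dec (s (left j) <? s (right b)))
  ... | yes separating = separating
  ... | no none = ⊥-elim (by-order adjacent)
    where
    strictly-between : ∀ t → ¬ (s (right a) < s t × s t < s (right b))
    strictly-between t (at , tb) with split t
    ... | inj₁ (j , refl) = none (j , at , tb)
    ... | inj₂ (c , refl) = no-suffix-between c (at , tb)
    right-adjacent : ∀ {x y} → suc (toℕ x) ≡ toℕ y → suc (toℕ (right x)) ≡ toℕ (right y)
    right-adjacent {x} {y} adj = trans (cong suc (toℕ-right x)) (trans (sym (+-suc k (toℕ x))) (trans (cong (k +_) adj) (sym (toℕ-right y))))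
    by-order : suc (toℕ a) ≡ toℕ b ⊎ suc (toℕ b) ≡ toℕ a → ⊥
    by-order (inj₁ a→b) = adjacent-separated (right-adjacent a→b)
      λ t _ → λ { (inj₁ between) → strictly-between t between ; (inj₂ (bt , ta)) → <-asym a<b (<-trans bt ta) }
    by-order (inj₂ b→a) = adjacent-separated (right-adjacent b→a)
      λ t _ → λ { (inj₁ (bt , ta)) → <-asym a<b (<-trans bt ta) ; (inj₂ between) → strictly-between t between }

  sv : Fin N → ℕ
  sv a = s (right a)

  open Standardisation sv (FP.↑ʳ-injective k _ _ ∘ seq-injective σ-inj) renaming (standardise to α)

  α-132 : Avoids (seq α) p132
  α-132 occurrence with occurs132 (seq α) occurrence
  ... | a , b , c , a<b , b<c , a<c , c<b =
    suffix-no132 (k≤right a) (right-< a<b , right-< b<c , from (standardise-orderIso a c) a<c , from (standardise-orderIso c b) c<b)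

  α-top : seq α 0F ≡ N
  α-top = trans (seq-standardise 0F) (count-all (λ c → sv c ≤? sv 0F) (λ c → peak-max (right c)))

  rank-last : rank (F.fromℕ n′) ≡ n′
  rank-last = ≤-antisym (≤-pred (subst (rank (F.fromℕ n′) <_) (trans (sym (seq-standardise 0F)) α-top) (rank-< last<peak)))
                        (count-allBut (λ c → sv c ≤? sv (F.fromℕ n′)) 0F below)
    where
    last<peak : sv (F.fromℕ n′) < sv 0F
    last<peak = below-peak last last≢k
    below : ∀ c → c ≢ 0F → sv c ≤ sv (F.fromℕ n′)
    below c c≢0 with c FP.≟ F.fromℕ n′
    ... | yes refl = ≤-refl
    ... | no c≢last = <⇒≤ (below-last (right c) (c≢0 ∘ right-at-peak) (c≢last ∘ FP.↑ʳ-injective k _ _))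
      where
      right-at-peak : toℕ (right c) ≡ k → c ≡ 0F
      right-at-peak eq = FP.↑ʳ-injective k _ _ (at-peak eq)

  α-bot : seq α (F.fromℕ n′) ≡ N ∸ 1
  α-bot = trans (seq-standardise _) rank-last

  Below : Fin k → Fin N → Set
  Below j c = sv c < s (left j)

  below? : ∀ j → Decidable (Below j)
  below? j c = sv c <? s (left j)

  -- The inserted entry j sits just below the row of value r j of α.
  r : Fin k → ℕ
  r j = suc (count (below? j))

  suffix≢left : ∀ c j → sv c ≢ s (left j)
  suffix≢left c j eq = left≢right j c (seq-injective σ-inj (sym eq))

  r-range : (j : Fin k) → 2 ≤ r j × r j ≤ N ∸ 1
  r-range j =
      s≤s (count-pos (below? j) (proj₁ (prefix-above-suffix j)) (proj₂ (prefix-above-suffix j)))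
    , subst (r j ≤_) rank-last
        (count-strictMono (below? j) (λ c → sv c ≤? sv (F.fromℕ n′)) (λ c c<j → <⇒≤ (<-trans c<j j<last))
                          (F.fromℕ n′) ≤-refl (<-asym j<last))
    where
    j<last : s (left j) < sv (F.fromℕ n′)
    j<last = below-last (left j) (<⇒≢ (left<k j)) (left≢right j _)

  prefix-incr : (i j : Fin k) → i F.< j → seq σ (i ↑ˡ N) < seq σ (j ↑ˡ N)
  prefix-incr i j i<j = prefix-< (subst₂ _<_ (sym (toℕ-left i)) (sym (toℕ-left j)) i<j) (left<k j)

  r-incr : (i j : Fin k) → i F.< j → r i < r j
  r-incr i j i<j = by-separator (consecutive-prefix-separated i next (sym (FP.toℕ-fromℕ< _)))
    where
    next : Fin k
    next = fromℕ< (≤-<-trans i<j (FP.toℕ<n j))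
    next≤j : s (left next) ≤ s (left j)
    next≤j = prefix-≤ (subst₂ _≤_ (sym (trans (toℕ-left next) (FP.toℕ-fromℕ< _))) (sym (toℕ-left j)) i<j) (left<k j)
    by-separator : (∃ λ c → s (left i) < sv c × sv c < s (left next)) → r i < r j
    by-separator (c , i<c , c<next) =
      s≤s (count-strictMono (below? i) (below? j) (λ x x<i → <-trans x<i (prefix-incr i j i<j)) c
                            (<-≤-trans c<next next≤j) (<-asym i<c))

  r-covers : (v : ℕ) → 2 ≤ v → v ≤ N ∸ 1 → (a b : Fin N) → seq α a ≡ v ∸ 1 → seq α b ≡ v →
             (suc (toℕ a) ≡ toℕ b ⊎ suc (toℕ b) ≡ toℕ a) → ∃[ j ] r j ≡ v
  r-covers v 2≤v _ a b α-a α-b adjacent =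
    by-separator (consecutive-suffix-separated a b adjacent nothing-between a<b)
    where
    0<v : 0 < v
    0<v = ≤-trans z<s 2≤v
    a<b : sv a < sv b
    a<b = from (standardise-orderIso a b) (subst₂ _<_ (sym α-a) (sym α-b) (n∸1<n 0<v))
    nothing-between : ∀ c → ¬ (sv a < sv c × sv c < sv b)
    nothing-between c (a<c , c<b) =
      <⇒≱ (subst (seq α c <_) α-b (to (standardise-orderIso c b) c<b))
          (subst (_≤ seq α c) (trans (cong suc α-a) (suc[n∸1]≡n 0<v)) (to (standardise-orderIso a c) a<c))
    by-separator : (∃ λ j → sv a < s (left j) × s (left j) < sv b) → ∃[ j ] r j ≡ v
    by-separator (j , a<j , j<b) = j , trans (cong suc count-below) (suc[n∸1]≡n 0<v)
      where
      count-below : count (below? j) ≡ v ∸ 1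
      count-below = trans (≤-antisym (count-mono (below? j) (λ c → sv c ≤? sv a) (λ c c<j → ≮⇒≥ (λ a<c → nothing-between c (a<c , <-trans c<j j<b))))
                                     (count-mono (λ c → sv c ≤? sv a) (below? j) (λ c c≤a → ≤-<-trans c≤a a<j)))
                          (trans (sym (seq-standardise a)) α-a)

  inserted-between : (j : Fin k) (a b : Fin N) → seq α a ≡ r j ∸ 1 → seq α b ≡ r j →
                     StrictlyBetween (seq σ (j ↑ˡ N)) (seq σ (k ↑ʳ a)) (seq σ (k ↑ʳ b))
  inserted-between j a b α-a α-b = inj₁ (a<j , j<b)
    where
    a<j : sv a < s (left j)
    a<j with <-cmp (sv a) (s (left j))
    ... | tri< a<j _ _ = a<j
    ... | tri≈ _ a≡j _ = contradiction a≡j (suffix≢left a j)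
    ... | tri> _ _ j<a = contradiction (trans (sym α-a) (seq-standardise a))
      (<⇒≢ (count-strictMono (below? j) (λ c → sv c ≤? sv a) (λ c c<j → <⇒≤ (<-trans c<j j<a)) a ≤-refl (<-asym j<a)))
    j<b : s (left j) < sv b
    j<b with <-cmp (sv b) (s (left j))
    ... | tri> _ _ j<b = j<b
    ... | tri≈ _ b≡j _ = contradiction b≡j (suffix≢left b j)
    ... | tri< b<j _ _ = ⊥-elim (1+n≰n (subst (_≤ count (below? j)) (trans (sym (seq-standardise b)) α-b)
                                   (count-mono (λ c → sv c ≤? sv b) (below? j) (λ c c≤b → ≤-<-trans c≤b b<j))))

  inT : InT (k + N) σ
  inT = mkT N k (s≤s n′≥2) α standardise-injective α-132 0F refl α-top (F.fromℕ n′) (cong suc (FP.toℕ-fromℕ n′)) α-bot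
            r r-range r-incr r-covers σ σ-inj prefix-incr standardise-orderIso inserted-between

contains⇒≤ : ∀ {n k} {s : Fin n → ℕ} {p : Fin k → ℕ} → Contains s p → k ≤ n
contains⇒≤ (f , f-incr , _) = FP.injective⇒≤ f-injective
  where
  f-injective : ∀ {i j} → f i ≡ f j → i ≡ j
  f-injective {i} {j} fi≡fj with <-cmp (toℕ i) (toℕ j)
  ... | tri< i<j _ _ = contradiction (cong toℕ fi≡fj) (<⇒≢ (f-incr i j i<j))
  ... | tri≈ _ i≡j _ = FP.toℕ-injective i≡j
  ... | tri> _ _ j<i = contradiction (cong toℕ (sym fi≡fj)) (<⇒≢ (f-incr j i j<i))

short-avoids : ∀ {m} (σ : Fin m → Fin m) → m ≤ 2 → InAv σ
short-avoids σ m≤2 = too-long , too-long , too-long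
  where
  too-long : ∀ {p : Fin 4 → ℕ} → Avoids (seq σ) p
  too-long occurrence = <⇒≱ <-literal (≤-trans (contains⇒≤ {s = seq σ} occurrence) m≤2)

simple-length1 : (σ : Fin 1 → Fin 1) → Simple σ
simple-length1 σ 0F 0F _ _ = inj₁ refl

simple-length2 : (σ : Fin 2 → Fin 2) → Simple σ
simple-length2 σ 0F 0F _ _ = inj₁ refl
simple-length2 σ 0F 1F _ _ = inj₂ refl
simple-length2 σ 1F 1F _ _ = inj₁ refl
simple-length2 σ 1F 0F () _

small⇒simple-avoider : ∀ {m} {σ : Fin m → Fin m} → Small m σ → Simple σ × InAv σ
small⇒simple-avoider (one σ _) = simple-length1 σ , short-avoids σ (s≤s z≤n)
small⇒simple-avoider (twelve σ _ _) = simple-length2 σ , short-avoids σ ≤-refl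
small⇒simple-avoider (twentyone σ _ _) = simple-length2 σ , short-avoids σ ≤-refl

T⇒simple-avoider : ∀ {m} {σ : Fin m → Fin m} → InT m σ → Simple σ × InAv σ
T⇒simple-avoider (mkT n k n≥3 α α-inj α-132 top top≡0 α-top bot bot≡last α-bot r r-range r-incr r-covers σ σ-inj
                      prefix-incr suffix-iso inserted-between) = simple , avoids
  where
  open TMember n k n≥3 α α-inj α-132 top top≡0 α-top bot bot≡last α-bot r r-range r-incr r-covers σ σ-inj
                 prefix-incr suffix-iso inserted-between

length2-small : (σ : Fin 2 → Fin 2) → IsPerm σ → Small 2 σ
length2-small σ σ-inj with σ 0F in σ0 | σ 1F in σ1
... | 0F | 1F = twelve σ (cong (suc ∘ toℕ) σ0) (cong (suc ∘ toℕ) σ1)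
... | 1F | 0F = twentyone σ (cong (suc ∘ toℕ) σ0) (cong (suc ∘ toℕ) σ1)
... | 0F | 0F with σ-inj (trans σ0 (sym σ1))
...   | ()
length2-small σ σ-inj | 1F | 1F with σ-inj (trans σ0 (sym σ1))
...   | ()

peak-at⇒T : ∀ k n′ {m} → k + suc n′ ≡ m → (σ : Fin m → Fin m) → IsPerm σ → Simple σ → InAv σ → 3 ≤ m →
            (peak : Fin m) → toℕ peak ≡ k → (∀ x → seq σ x ≤ seq σ peak) → InT m σ
peak-at⇒T k n′ refl σ σ-inj σ-simple σ-avoids m≥3 peak toℕ-peak peak-max =
  SimpleAvoider.inT k n′ σ σ-inj σ-simple σ-avoids m≥3 (λ x → subst (λ p → seq σ x ≤ seq σ p) peak≡ (peak-max x))
  where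
  peak≡ : peak ≡ k ↑ʳ 0F
  peak≡ = FP.toℕ-injective (trans toℕ-peak (sym (trans (FP.toℕ-↑ʳ k 0F) (+-identityʳ k))))

simple-avoider⇒T : ∀ {m} (σ : Fin m → Fin m) → IsPerm σ → Simple σ → InAv σ → 3 ≤ m → InT m σ
simple-avoider⇒T {m} σ σ-inj σ-simple σ-avoids m≥3
  with argmax {P = λ _ → ⊤} (λ _ → yes tt) (seq σ) (F.fromℕ< (≤-trans z<s m≥3) , tt)
... | peak , _ , peak-max =
  peak-at⇒T (toℕ peak) (m ∸ suc (toℕ peak)) (trans (+-suc (toℕ peak) _) (m+[n∸m]≡n (FP.toℕ<n peak)))
            σ σ-inj σ-simple σ-avoids m≥3 peak refl (λ x → peak-max x tt)

simple-avoider⇒T-or-small : ∀ m → 1 ≤ m → (σ : Fin m → Fin m) → IsPerm σ → Simple σ × InAv σ → InT m σ ⊎ Small m σ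
simple-avoider⇒T-or-small 1 _ σ _ _ with σ 0F in σ0
... | 0F = inj₂ (one σ (cong (suc ∘ toℕ) σ0))
simple-avoider⇒T-or-small 2 _ σ σ-inj _ = inj₂ (length2-small σ σ-inj)
simple-avoider⇒T-or-small (suc (suc (suc m))) _ σ σ-inj (σ-simple , σ-avoids) =
  inj₁ (simple-avoider⇒T σ σ-inj σ-simple σ-avoids (s≤s (s≤s (s≤s z≤n))))

lemma7 : (m : ℕ) → 1 ≤ m → (σ : Fin m → Fin m) → IsPerm σ →
    (Simple σ × InAv σ) ⇔ (InT m σ ⊎ Small m σ)
lemma7 m m≥1 σ σ-inj = mk⇔ (simple-avoider⇒T-or-small m m≥1 σ σ-inj) λ where
  (inj₁ σ∈T) → T⇒simple-avoider σ∈T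
  (inj₂ σ-small) → small⇒simple-avoider σ-small
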